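{- Let $F$ be an hke collection, let $A\in F$ and let $E\subseteq A$. Then there exists a finite set $D$ such that: (1) $A\cap D=E$; (2) $F\cup\{D\}$ is an hke collection; (3) $|D-\bigcup F|=|\bigcap F-E|$. In particular, if $\bigcap F=\emptyset$ then $D\subseteq\bigcup F$.
   Context: A non-empty finite collection $F$ of finite sets is an \emph{hke collection} if there is a positive integer $\alpha$ such that $|\bigcup \Gamma|+|\bigcap \Gamma|=2\alpha$ for every non-empty subcollection $\Gamma\subseteq F$. -}

module Defs where

open import Data.Nat using (ℕ; _+_; _*_; _<_; _≟_)
open import Data.List using (List; []; _∷_; filter; concat; length; deduplicate)
open import Data.List.Relation.Unary.All using (all?)
open import Data.List.Membership.DecPropositional _≟_ using (_∈?_)
open import Data.List.Membership.Propositional using (_∈_)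
open import Data.List.Relation.Binary.Subset.Propositional using (_⊆_)
open import Data.Product using (_×_; ∃-syntax)
open import Relation.Nullary using (¬_; ¬?)
open import Relation.Nullary.Decidable using (⌊_⌋)
open import Relation.Binary.PropositionalEquality using (_≡_; _≢_)

-- A finite set (of elements of the infinite universe ℕ) is represented by a
-- list of its elements; duplicates and order are irrelevant: membership is
-- list membership, and cardinality counts distinct elements.
FinSet : Set
FinSet = List ℕ

∣_∣ : FinSet → ℕ
∣ X ∣ = length (deduplicate _≟_ X)

_≈_ : FinSet → FinSet → Set
X ≈ Y = (X ⊆ Y) × (Y ⊆ X)

_∩_ : FinSet → FinSet → FinSet
X ∩ Y = filter (_∈? Y) X

_─_ : FinSet → FinSet → FinSet
X ─ Y = filter (λ x → ¬? (x ∈? Y)) X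

Collection : Set
Collection = List FinSet

⋃ : Collection → FinSet
⋃ Γ = concat Γ

-- ⋂ Γ (only meaningful for non-empty Γ; we set ⋂ [] = ∅, never used)
⋂ : Collection → FinSet
⋂ [] = []
⋂ (X ∷ Γ) = filter (λ x → all? (x ∈?_) Γ) X

_⊑_ : Collection → Collection → Set
Γ ⊑ F = ∀ {X} → X ∈ Γ → X ∈ F

IsHKE : Collection → Set
IsHKE F = (F ≢ []) × ∃[ α ] ((0 < α) ×
  (∀ (Γ : Collection) → Γ ≢ [] → Γ ⊑ F → ∣ ⋃ Γ ∣ + ∣ ⋂ Γ ∣ ≡ 2 * α))

module Submission where

-- The hke condition makes the Venn diagram of an hke collection G symmetric:
-- for non-empty I, O ⊆ G, the number of points lying in every member of I and
-- in no member of O is unchanged when I and O are swapped (induction on I; the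
-- base case is the hke identity for O and Z ∷ O).  Hence every point e of a
-- member D has a partner y, lying in exactly those members of G that miss e,
-- and replacing e by y in D keeps the collection hke: for every subcollection,
-- ∣ ⋃ ∣ + ∣ ⋂ ∣ is unchanged away from {e, y} and equals 2 on {e, y} both before
-- and after.  Doing this for each point of A − E in turn produces D; the points
-- of D outside ⋃ F are exactly the partners of the points of ⋂ F − E.

open import Defs
open import Algebra.Properties.CommutativeSemigroup as CSemigroup using ()
open import Data.Nat using (ℕ; suc; _+_; _*_; _<_; _≟_; z≤n; s≤s)
open import Data.Nat.Properties using (+-comm; +-assoc; +-suc; +-cancelˡ-≡; +-cancelʳ-≡; 1+n≰n; +-commutativeSemigroup)
open import Data.List using (List; []; _∷_; _++_; filter; length; deduplicate)
open import Data.List.Properties using (≡-dec)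
open import Data.List.Extrema.Nat using (max; xs≤max)
open import Data.List.Relation.Unary.All as All using (All; []; _∷_; all?)
open import Data.List.Relation.Unary.All.Properties using (¬All⇒Any¬)
open import Data.List.Relation.Unary.Any using (here; there)
open import Data.List.Relation.Unary.AllPairs using ([]; _∷_)
open import Data.List.Relation.Unary.Unique.Propositional using (Unique)
import Data.List.Relation.Unary.Unique.Propositional.Properties as Unique
open import Data.List.Relation.Unary.Unique.DecPropositional.Properties _≟_ using (deduplicate-!)
open import Data.List.Relation.Binary.Pointwise as Pointwise using (Pointwise; []; _∷_)
open import Data.List.Relation.Binary.Subset.Propositional using (_⊆_)
open import Data.List.Relation.Binary.BagAndSetEquality using (∼bag⇒↭)
open import Data.List.Relation.Binary.Permutation.Propositional.Properties using (↭-length)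
open import Data.List.Membership.DecPropositional _≟_ using (_∈?_)
open import Data.List.Membership.DecPropositional (≡-dec _≟_) using () renaming (_∈?_ to _∈ᶜ?_)
open import Data.List.Membership.Propositional using (_∈_; _∉_; find)
open import Data.List.Membership.Propositional.Properties
open import Data.List.Membership.Propositional.Properties.WithK using (unique∧set⇒bag)
open import Data.Product using (_×_; _,_; proj₁; proj₂; ∃-syntax)
open import Data.Sum using (_⊎_; inj₁; inj₂; [_,_])
open import Data.Empty using (⊥-elim)
open import Function.Bundles using (mk⇔)
open import Relation.Nullary using (¬?; yes; no)
open import Relation.Unary using (Pred; Decidable)
open import Relation.Binary.Definitions using (DecidableEquality)
open import Relation.Binary.PropositionalEquality using (_≡_; _≢_; refl; sym; trans; cong; cong₂; subst; module ≡-Reasoning)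

open CSemigroup +-commutativeSemigroup using (interchange; xy∙z≈xz∙y)

open ≡-Reasoning

_≟ᶜ_ : DecidableEquality FinSet
_≟ᶜ_ = ≡-dec _≟_

private
  variable
    x e y : ℕ
    X Y Z D : FinSet
    Γ Δ G I O : Collection

≈-sym : X ≈ Y → Y ≈ X
≈-sym (X⊆Y , Y⊆X) = Y⊆X , X⊆Y

≈-trans : X ≈ Y → Y ≈ Z → X ≈ Z
≈-trans (X⊆Y , Y⊆X) (Y⊆Z , Z⊆Y) = (λ p → Y⊆Z (X⊆Y p)) , (λ p → Y⊆X (Z⊆Y p))

∈-∩⁺ : x ∈ X → x ∈ Y → x ∈ X ∩ Y
∈-∩⁺ {Y = Y} = ∈-filter⁺ (_∈? Y)

∈-∩⁻ : ∀ X Y → x ∈ X ∩ Y → x ∈ X × x ∈ Y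
∈-∩⁻ X Y = ∈-filter⁻ (_∈? Y) {xs = X}

∈-─⁺ : x ∈ X → x ∉ Y → x ∈ X ─ Y
∈-─⁺ {Y = Y} = ∈-filter⁺ (λ x → ¬? (x ∈? Y))

∈-─⁻ : ∀ X Y → x ∈ X ─ Y → x ∈ X × x ∉ Y
∈-─⁻ X Y = ∈-filter⁻ (λ x → ¬? (x ∈? Y)) {xs = X}

∩-comm : ∀ X Y → (X ∩ Y) ≈ (Y ∩ X)
∩-comm X Y = (λ p → let x∈X , x∈Y = ∈-∩⁻ X Y p in ∈-∩⁺ x∈Y x∈X)
           , (λ p → let x∈Y , x∈X = ∈-∩⁻ Y X p in ∈-∩⁺ x∈X x∈Y)

∩-congʳ : ∀ X → Y ≈ Z → (X ∩ Y) ≈ (X ∩ Z)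
∩-congʳ {Y} {Z} X (Y⊆Z , Z⊆Y) = (λ p → let x∈X , x∈Y = ∈-∩⁻ X Y p in ∈-∩⁺ x∈X (Y⊆Z x∈Y))
                              , (λ p → let x∈X , x∈Z = ∈-∩⁻ X Z p in ∈-∩⁺ x∈X (Z⊆Y x∈Z))

deduplicate-≈ : ∀ X → (deduplicate _≟_ X) ≈ X
deduplicate-≈ X = ∈-deduplicate⁻ _≟_ X , ∈-deduplicate⁺ _≟_

filter-≈ : ∀ {p} {Q : Pred ℕ p} (Q? : Decidable Q) → X ≈ Y → (filter Q? X) ≈ (filter Q? Y)
filter-≈ {X = X} {Y = Y} Q? (X⊆Y , Y⊆X) =
    (λ p → let x∈X , Qx = ∈-filter⁻ Q? {xs = X} p in ∈-filter⁺ Q? (X⊆Y x∈X) Qx)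
  , (λ p → let x∈Y , Qx = ∈-filter⁻ Q? {xs = Y} p in ∈-filter⁺ Q? (Y⊆X x∈Y) Qx)

∣∣-unique : ∀ {U} → Unique U → X ≈ U → ∣ X ∣ ≡ length U
∣∣-unique {X} uU (X⊆U , U⊆X) =
  ↭-length (∼bag⇒↭ (unique∧set⇒bag (deduplicate-! X) uU
    (mk⇔ (λ p → X⊆U (∈-deduplicate⁻ _≟_ X p)) (λ p → ∈-deduplicate⁺ _≟_ (U⊆X p)))))

∣∣-cong : X ≈ Y → ∣ X ∣ ≡ ∣ Y ∣
∣∣-cong {Y = Y} X≈Y = ∣∣-unique (deduplicate-! Y) (≈-trans X≈Y (≈-sym (deduplicate-≈ Y)))

length-filter-split : ∀ {p} {Q : Pred ℕ p} (Q? : Decidable Q) (xs : List ℕ) →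
  length xs ≡ length (filter Q? xs) + length (filter (λ x → ¬? (Q? x)) xs)
length-filter-split Q? [] = refl
length-filter-split Q? (x ∷ xs) with Q? x
... | yes _ = cong suc (length-filter-split Q? xs)
... | no _ = trans (cong suc (length-filter-split Q? xs)) (sym (+-suc _ _))

∣∣-split : ∀ X Y → ∣ X ∣ ≡ ∣ X ∩ Y ∣ + ∣ X ─ Y ∣
∣∣-split X Y = begin
  ∣ X ∣                                                  ≡⟨ length-filter-split (_∈? Y) dX ⟩
  length (filter (_∈? Y) dX) + length (filter (λ x → ¬? (x ∈? Y)) dX)
    ≡⟨ cong₂ _+_ (∣∣-unique (Unique.filter⁺ (_∈? Y) udX) (filter-≈ (_∈? Y) X≈dX))
                 (∣∣-unique (Unique.filter⁺ (λ x → ¬? (x ∈? Y)) udX) (filter-≈ (λ x → ¬? (x ∈? Y)) X≈dX)) ⟨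
  ∣ X ∩ Y ∣ + ∣ X ─ Y ∣                                  ∎
  where
  dX : List ℕ
  dX = deduplicate _≟_ X
  udX : Unique dX
  udX = deduplicate-! X
  X≈dX : X ≈ dX
  X≈dX = ≈-sym (deduplicate-≈ X)

∣++∣ : ∀ X Y → ∣ X ++ Y ∣ ≡ ∣ Y ∣ + ∣ X ─ Y ∣
∣++∣ X Y = trans (∣∣-split (X ++ Y) Y) (cong₂ _+_ (∣∣-cong [X++Y]∩Y≈Y) (∣∣-cong [X++Y]─Y≈X─Y))
  where
  [X++Y]∩Y≈Y : ((X ++ Y) ∩ Y) ≈ Y
  [X++Y]∩Y≈Y = (λ p → proj₂ (∈-∩⁻ (X ++ Y) Y p)) , (λ p → ∈-∩⁺ (∈-++⁺ʳ X p) p)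
  [X++Y]─Y≈X─Y : ((X ++ Y) ─ Y) ≈ (X ─ Y)
  [X++Y]─Y≈X─Y = (λ p → let x∈X++Y , x∉Y = ∈-─⁻ (X ++ Y) Y p in ∈-─⁺ (from-X x∈X++Y x∉Y) x∉Y)
               , (λ p → let x∈X , x∉Y = ∈-─⁻ X Y p in ∈-─⁺ (∈-++⁺ˡ x∈X) x∉Y)
    where
    from-X : x ∈ X ++ Y → x ∉ Y → x ∈ X
    from-X p x∉Y with ∈-++⁻ X p
    ... | inj₁ x∈X = x∈X
    ... | inj₂ x∈Y = ⊥-elim (x∉Y x∈Y)

∈⇒∣∣>0 : x ∈ X → 0 < ∣ X ∣
∈⇒∣∣>0 {X = X} x∈X with deduplicate _≟_ X | ∈-deduplicate⁺ _≟_ {xs = X} x∈X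
... | _ ∷ _ | _ = s≤s z≤n

∣∣>0⇒∈ : 0 < ∣ X ∣ → ∃[ x ] x ∈ X
∣∣>0⇒∈ {X = X} ∣X∣>0 with deduplicate _≟_ X in eq
... | x ∷ _ = x , ∈-deduplicate⁻ _≟_ X (subst (x ∈_) (sym eq) (here refl))

∈-⋂⁺ : Γ ≢ [] → All (x ∈_) Γ → x ∈ ⋂ Γ
∈-⋂⁺ {Γ = []} Γ≢[] _ = ⊥-elim (Γ≢[] refl)
∈-⋂⁺ {Γ = X ∷ Γ} _ (x∈X ∷ x∈Γ) = ∈-filter⁺ (λ y → all? (y ∈?_) Γ) x∈X x∈Γ

∈-⋂⁻ : ∀ Γ → x ∈ ⋂ Γ → All (x ∈_) Γ
∈-⋂⁻ (X ∷ Γ) p = let x∈X , x∈Γ = ∈-filter⁻ (λ y → all? (y ∈?_) Γ) {xs = X} p in x∈X ∷ x∈Γ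

⋂⊆ : X ∈ Γ → ⋂ Γ ⊆ X
⋂⊆ X∈Γ p = All.lookup (∈-⋂⁻ _ p) X∈Γ

⋃-mono : Γ ⊑ Δ → ⋃ Γ ⊆ ⋃ Δ
⋃-mono {Γ} Γ⊑Δ p = let X , x∈X , X∈Γ = ∈-concat⁻′ Γ p in ∈-concat⁺′ x∈X (Γ⊑Δ X∈Γ)

⋂-antimono : Γ ≢ [] → Γ ⊑ Δ → ⋂ Δ ⊆ ⋂ Γ
⋂-antimono {Δ = Δ} Γ≢[] Γ⊑Δ p = ∈-⋂⁺ Γ≢[] (All.tabulate (λ X∈Γ → All.lookup (∈-⋂⁻ Δ p) (Γ⊑Δ X∈Γ)))

⋂∷≈ : O ≢ [] → (⋂ (Z ∷ O)) ≈ (⋂ O ∩ Z)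
⋂∷≈ {O} {Z} O≢[] =
    (λ p → ∈-∩⁺ (∈-⋂⁺ O≢[] (All.tail (∈-⋂⁻ (Z ∷ O) p))) (All.head (∈-⋂⁻ (Z ∷ O) p)))
  , (λ p → let x∈⋂O , x∈Z = ∈-∩⁻ (⋂ O) Z p in ∈-⋂⁺ (λ ()) (x∈Z ∷ ∈-⋂⁻ O x∈⋂O))

hkeSum : Collection → ℕ
hkeSum Γ = ∣ ⋃ Γ ∣ + ∣ ⋂ Γ ∣

HasHKESum : Collection → ℕ → Set
HasHKESum G α = ∀ Γ → Γ ≢ [] → Γ ⊑ G → hkeSum Γ ≡ 2 * α

region : Collection → Collection → FinSet
region I O = ⋂ I ─ ⋃ O

region-∩ : I ≢ [] → (region I O ∩ Z) ≈ region (Z ∷ I) O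
region-∩ {I} {O} {Z} I≢[] =
    (λ p → let x∈r , x∈Z = ∈-∩⁻ (region I O) Z p
               x∈⋂I , x∉⋃O = ∈-─⁻ (⋂ I) (⋃ O) x∈r
           in ∈-─⁺ (∈-⋂⁺ (λ ()) (x∈Z ∷ ∈-⋂⁻ I x∈⋂I)) x∉⋃O)
  , (λ p → let x∈⋂ZI , x∉⋃O = ∈-─⁻ (⋂ (Z ∷ I)) (⋃ O) p
               x∈ZI = ∈-⋂⁻ (Z ∷ I) x∈⋂ZI
           in ∈-∩⁺ (∈-─⁺ (∈-⋂⁺ I≢[] (All.tail x∈ZI)) x∉⋃O) (All.head x∈ZI))

region-─ : (region I O ─ Z) ≈ region I (Z ∷ O)
region-─ {I} {O} {Z} =
    (λ p → let x∈r , x∉Z = ∈-─⁻ (region I O) Z p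
               x∈⋂I , x∉⋃O = ∈-─⁻ (⋂ I) (⋃ O) x∈r
           in ∈-─⁺ x∈⋂I (λ q → [ x∉Z , x∉⋃O ] (∈-++⁻ Z q)))
  , (λ p → let x∈⋂I , x∉⋃ZO = ∈-─⁻ (⋂ I) (⋃ (Z ∷ O)) p
           in ∈-─⁺ (∈-─⁺ x∈⋂I (λ q → x∉⋃ZO (∈-++⁺ʳ Z q))) (λ q → x∉⋃ZO (∈-++⁺ˡ q)))

∣region∣-split : ∀ I O Z → I ≢ [] → ∣ region I O ∣ ≡ ∣ region (Z ∷ I) O ∣ + ∣ region I (Z ∷ O) ∣
∣region∣-split I O Z I≢[] =
  trans (∣∣-split (region I O) Z) (cong₂ _+_ (∣∣-cong (region-∩ {I} {O} {Z} I≢[])) (∣∣-cong (region-─ {I} {O} {Z})))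

module _ {G : Collection} {α : ℕ} (hke : HasHKESum G α) where

  ∣─⋃∣≡∣⋂─∣ : Z ∈ G → O ≢ [] → O ⊑ G → ∣ Z ─ ⋃ O ∣ ≡ ∣ ⋂ O ─ Z ∣
  ∣─⋃∣≡∣⋂─∣ {Z} {O} Z∈G O≢[] O⊑G = +-cancelˡ-≡ (∣ ⋃ O ∣ + ∣ ⋂ O ∩ Z ∣) _ _ (begin
    (∣ ⋃ O ∣ + ∣ ⋂ O ∩ Z ∣) + ∣ Z ─ ⋃ O ∣  ≡⟨ xy∙z≈xz∙y ∣ ⋃ O ∣ _ _ ⟩
    (∣ ⋃ O ∣ + ∣ Z ─ ⋃ O ∣) + ∣ ⋂ O ∩ Z ∣  ≡⟨ cong₂ _+_ (∣++∣ Z (⋃ O)) (∣∣-cong (⋂∷≈ O≢[])) ⟨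
    ∣ ⋃ (Z ∷ O) ∣ + ∣ ⋂ (Z ∷ O) ∣          ≡⟨ hke (Z ∷ O) (λ ()) ZO⊑G ⟩
    2 * α                                   ≡⟨ hke O O≢[] O⊑G ⟨
    ∣ ⋃ O ∣ + ∣ ⋂ O ∣                       ≡⟨ cong (∣ ⋃ O ∣ +_) (∣∣-split (⋂ O) Z) ⟩
    ∣ ⋃ O ∣ + (∣ ⋂ O ∩ Z ∣ + ∣ ⋂ O ─ Z ∣)  ≡⟨ +-assoc ∣ ⋃ O ∣ _ _ ⟨
    (∣ ⋃ O ∣ + ∣ ⋂ O ∩ Z ∣) + ∣ ⋂ O ─ Z ∣  ∎)
    where
    ZO⊑G : (Z ∷ O) ⊑ G
    ZO⊑G (here refl) = Z∈G
    ZO⊑G (there X∈O) = O⊑G X∈O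

  ∣region∣-sym : ∀ I O → I ≢ [] → O ≢ [] → I ⊑ G → O ⊑ G → ∣ region I O ∣ ≡ ∣ region O I ∣
  ∣region∣-sym [] _ []≢[] _ _ _ = ⊥-elim ([]≢[] refl)
  ∣region∣-sym (Z ∷ []) O _ O≢[] I⊑G O⊑G = begin
    ∣ region (Z ∷ []) O ∣  ≡⟨ ∣∣-cong region-singleton-in ⟩
    ∣ Z ─ ⋃ O ∣            ≡⟨ ∣─⋃∣≡∣⋂─∣ (I⊑G (here refl)) O≢[] O⊑G ⟩
    ∣ ⋂ O ─ Z ∣            ≡⟨ ∣∣-cong region-singleton-out ⟨
    ∣ region O (Z ∷ []) ∣  ∎
    where
    region-singleton-in : region (Z ∷ []) O ≈ (Z ─ ⋃ O)
    region-singleton-in =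
        (λ p → let x∈⋂ , x∉⋃O = ∈-─⁻ (⋂ (Z ∷ [])) (⋃ O) p in ∈-─⁺ (⋂⊆ {Γ = Z ∷ []} (here refl) x∈⋂) x∉⋃O)
      , (λ p → let x∈Z , x∉⋃O = ∈-─⁻ Z (⋃ O) p in ∈-─⁺ (∈-⋂⁺ (λ ()) (x∈Z ∷ [])) x∉⋃O)
    region-singleton-out : region O (Z ∷ []) ≈ (⋂ O ─ Z)
    region-singleton-out =
        (λ p → let x∈⋂O , x∉Z++[] = ∈-─⁻ (⋂ O) (Z ++ []) p in ∈-─⁺ x∈⋂O (λ q → x∉Z++[] (∈-++⁺ˡ q)))
      , (λ p → let x∈⋂O , x∉Z = ∈-─⁻ (⋂ O) Z p in ∈-─⁺ x∈⋂O (λ q → [ x∉Z , (λ ()) ] (∈-++⁻ Z q)))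
  ∣region∣-sym (Z ∷ I@(_ ∷ _)) O _ O≢[] ZI⊑G O⊑G = +-cancelʳ-≡ _ _ _ (begin
    ∣ region (Z ∷ I) O ∣ + ∣ region I (Z ∷ O) ∣  ≡⟨ ∣region∣-split I O Z (λ ()) ⟨
    ∣ region I O ∣                                ≡⟨ ∣region∣-sym I O (λ ()) O≢[] I⊑G O⊑G ⟩
    ∣ region O I ∣                                ≡⟨ ∣region∣-split O I Z O≢[] ⟩
    ∣ region (Z ∷ O) I ∣ + ∣ region O (Z ∷ I) ∣  ≡⟨ +-comm ∣ region (Z ∷ O) I ∣ _ ⟩
    ∣ region O (Z ∷ I) ∣ + ∣ region (Z ∷ O) I ∣  ≡⟨ cong (∣ region O (Z ∷ I) ∣ +_) (∣region∣-sym I (Z ∷ O) (λ ()) (λ ()) I⊑G ZO⊑G) ⟨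
    ∣ region O (Z ∷ I) ∣ + ∣ region I (Z ∷ O) ∣  ∎)
    where
    I⊑G : I ⊑ G
    I⊑G X∈I = ZI⊑G (there X∈I)
    ZO⊑G : (Z ∷ O) ⊑ G
    ZO⊑G (here refl) = ZI⊑G (here refl)
    ZO⊑G (there X∈O) = O⊑G X∈O

Partner : Collection → ℕ → ℕ → Set
Partner G e y = ∀ {X} → X ∈ G → (y ∈ X → e ∉ X) × (e ∉ X → y ∈ X)

partner-sym : Partner G e y → Partner G y e
partner-sym {e = e} py {X} X∈G = (λ e∈X y∈X → proj₁ (py X∈G) y∈X e∈X) , y∉X⇒e∈X
  where
  y∉X⇒e∈X : _ ∉ X → e ∈ X
  y∉X⇒e∈X y∉X with e ∈? X
  ... | yes e∈X = e∈X
  ... | no e∉X = ⊥-elim (y∉X (proj₂ (py X∈G) e∉X))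

partner-⋂⋃ : Γ ≢ [] → Partner Γ e y → (e ∈ ⋂ Γ → y ∉ ⋃ Γ) × (y ∉ ⋃ Γ → e ∈ ⋂ Γ)
partner-⋂⋃ {Γ} Γ≢[] py =
    (λ e∈⋂ y∈⋃ → let X , y∈X , X∈Γ = ∈-concat⁻′ Γ y∈⋃ in proj₁ (py X∈Γ) y∈X (⋂⊆ X∈Γ e∈⋂))
  , (λ y∉⋃ → ∈-⋂⁺ Γ≢[] (All.tabulate (λ X∈Γ → proj₂ (partner-sym py X∈Γ) λ y∈X → y∉⋃ (∈-concat⁺′ y∈X X∈Γ))))

fresh : ∀ xs → ∃[ y ] y ∉ xs
fresh xs = suc (max 0 xs) , λ y∈xs → 1+n≰n (All.lookup (xs≤max 0 xs) y∈xs)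

∈⇒≢[] : ∀ {A : Set} {a : A} {as} → a ∈ as → as ≢ []
∈⇒≢[] (here _) ()
∈⇒≢[] (there _) ()

partner-exists : ∀ {α} → HasHKESum G α → D ∈ G → e ∈ D → ∃[ y ] Partner G e y
partner-exists {G} {e = e} {α} hke D∈G e∈D with all? (e ∈?_) G
... | yes e∈all = let y , y∉⋃G = fresh (⋃ G) in
  y , λ X∈G → (λ y∈X → ⊥-elim (y∉⋃G (∈-concat⁺′ y∈X X∈G))) , (λ e∉X → ⊥-elim (e∉X (All.lookup e∈all X∈G)))
... | no ¬e∈all = let y , y∈region = region-inhabited in y , region⇒partner y∈region
  where
  In Out : Collection
  In = filter (e ∈?_) G
  Out = filter (λ X → ¬? (e ∈? X)) G
  In⊑G : In ⊑ G
  In⊑G X∈In = proj₁ (∈-filter⁻ (e ∈?_) {xs = G} X∈In)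
  Out⊑G : Out ⊑ G
  Out⊑G X∈Out = proj₁ (∈-filter⁻ (λ X → ¬? (e ∈? X)) {xs = G} X∈Out)
  In≢[] : In ≢ []
  In≢[] = ∈⇒≢[] (∈-filter⁺ (e ∈?_) D∈G e∈D)
  Out≢[] : Out ≢ []
  Out≢[] = let X , X∈G , e∉X = find (¬All⇒Any¬ (e ∈?_) G ¬e∈all)
           in ∈⇒≢[] (∈-filter⁺ (λ X → ¬? (e ∈? X)) X∈G e∉X)
  e∈region : e ∈ region In Out
  e∈region = ∈-─⁺ (∈-⋂⁺ In≢[] (All.tabulate (λ X∈In → proj₂ (∈-filter⁻ (e ∈?_) {xs = G} X∈In))))
                  (λ e∈⋃ → let X , e∈X , X∈Out = ∈-concat⁻′ Out e∈⋃
                           in proj₂ (∈-filter⁻ (λ X → ¬? (e ∈? X)) {xs = G} X∈Out) e∈X)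
  region-inhabited : ∃[ y ] y ∈ region Out In
  region-inhabited = ∣∣>0⇒∈ (subst (0 <_) (∣region∣-sym {α = α} hke In Out In≢[] Out≢[] In⊑G Out⊑G) (∈⇒∣∣>0 e∈region))
  region⇒partner : y ∈ region Out In → Partner G e y
  region⇒partner y∈region {X} X∈G with ∈-─⁻ (⋂ Out) (⋃ In) y∈region | e ∈? X
  ... | _ , y∉⋃In | yes e∈X = (λ y∈X → ⊥-elim (y∉⋃In (∈-concat⁺′ y∈X (∈-filter⁺ (e ∈?_) X∈G e∈X)))) , (λ e∉X → ⊥-elim (e∉X e∈X))
  ... | y∈⋂Out , _ | no e∉X = (λ _ → e∉X) , (λ _ → ⋂⊆ (∈-filter⁺ (λ X → ¬? (e ∈? X)) X∈G e∉X) y∈⋂Out)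

hkeSum-cong : Γ ≢ [] → Δ ≢ [] → Γ ⊑ Δ → Δ ⊑ Γ → hkeSum Γ ≡ hkeSum Δ
hkeSum-cong Γ≢[] Δ≢[] Γ⊑Δ Δ⊑Γ =
  cong₂ _+_ (∣∣-cong (⋃-mono Γ⊑Δ , ⋃-mono Δ⊑Γ)) (∣∣-cong (⋂-antimono Δ≢[] Δ⊑Γ , ⋂-antimono Γ≢[] Γ⊑Δ))

hkeSum-split : ∀ Γ P → hkeSum Γ ≡ (∣ ⋃ Γ ∩ P ∣ + ∣ ⋂ Γ ∩ P ∣) + (∣ ⋃ Γ ─ P ∣ + ∣ ⋂ Γ ─ P ∣)
hkeSum-split Γ P = trans (cong₂ _+_ (∣∣-split (⋃ Γ) P) (∣∣-split (⋂ Γ) P)) (interchange ∣ ⋃ Γ ∩ P ∣ ∣ ⋃ Γ ─ P ∣ ∣ ⋂ Γ ∩ P ∣ ∣ ⋂ Γ ─ P ∣)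

pair-count : Partner Γ e y → e ∈ ⋃ Γ → ∣ ⋃ Γ ∩ (e ∷ y ∷ []) ∣ + ∣ ⋂ Γ ∩ (e ∷ y ∷ []) ∣ ≡ 2
pair-count {Γ} {e} {y} py e∈⋃ with ∈-concat⁻′ Γ e∈⋃
... | X , e∈X , X∈Γ = begin
  ∣ ⋃ Γ ∩ P ∣ + ∣ ⋂ Γ ∩ P ∣                                    ≡⟨ cong₂ _+_ (∣∩P∣ (⋃ Γ)) (∣∩P∣ (⋂ Γ)) ⟩
  length (filter (_∈? ⋃ Γ) P) + length (filter (_∈? ⋂ Γ) P)  ≡⟨ count ⟩
  2                                                           ∎
  where
  P : FinSet
  P = e ∷ y ∷ []
  y∉X : y ∉ X
  y∉X y∈X = proj₁ (py X∈Γ) y∈X e∈X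
  e≢y : e ≢ y
  e≢y refl = y∉X e∈X
  ∣∩P∣ : ∀ S → ∣ S ∩ P ∣ ≡ length (filter (_∈? S) P)
  ∣∩P∣ S = ∣∣-unique (Unique.filter⁺ (_∈? S) ((e≢y ∷ []) ∷ [] ∷ [])) (∩-comm S P)
  exactly-one : (e ∈ ⋂ Γ → y ∉ ⋃ Γ) × (y ∉ ⋃ Γ → e ∈ ⋂ Γ)
  exactly-one = partner-⋂⋃ (∈⇒≢[] X∈Γ) py
  count : length (filter (_∈? ⋃ Γ) P) + length (filter (_∈? ⋂ Γ) P) ≡ 2
  count with e ∈? ⋃ Γ | e ∈? ⋂ Γ
  ... | no e∉⋃ | _ = ⊥-elim (e∉⋃ e∈⋃)
  ... | yes _ | yes e∈⋂ with y ∈? ⋃ Γ | y ∈? ⋂ Γ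
  ...   | yes y∈⋃ | _ = ⊥-elim (proj₁ exactly-one e∈⋂ y∈⋃)
  ...   | _ | yes y∈⋂ = ⊥-elim (y∉X (⋂⊆ X∈Γ y∈⋂))
  ...   | no _ | no _ = refl
  count | yes _ | no e∉⋂ with y ∈? ⋃ Γ | y ∈? ⋂ Γ
  ...   | no y∉⋃ | _ = ⊥-elim (e∉⋂ (proj₂ exactly-one y∉⋃))
  ...   | _ | yes y∈⋂ = ⊥-elim (y∉X (⋂⊆ X∈Γ y∈⋂))
  ...   | yes _ | no _ = refl

module _ {P X X′ : FinSet} (X─P⊆X′─P : (X ─ P) ⊆ (X′ ─ P)) where

  ⋃∷-─-mono : ∀ Γ → (⋃ (X ∷ Γ) ─ P) ⊆ (⋃ (X′ ∷ Γ) ─ P)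
  ⋃∷-─-mono Γ p with ∈-─⁻ (X ++ ⋃ Γ) P p
  ... | x∈X++⋃Γ , x∉P with ∈-++⁻ X x∈X++⋃Γ
  ... | inj₁ x∈X = ∈-─⁺ (∈-++⁺ˡ (proj₁ (∈-─⁻ X′ P (X─P⊆X′─P (∈-─⁺ x∈X x∉P))))) x∉P
  ... | inj₂ x∈⋃Γ = ∈-─⁺ (∈-++⁺ʳ X′ x∈⋃Γ) x∉P

  ⋂∷-─-mono : ∀ Γ → (⋂ (X ∷ Γ) ─ P) ⊆ (⋂ (X′ ∷ Γ) ─ P)
  ⋂∷-─-mono Γ p =
    let x∈⋂ , x∉P = ∈-─⁻ (⋂ (X ∷ Γ)) P p
        x∈XΓ = ∈-⋂⁻ (X ∷ Γ) x∈⋂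
        x∈X′ = proj₁ (∈-─⁻ X′ P (X─P⊆X′─P (∈-─⁺ (All.head x∈XΓ) x∉P)))
    in ∈-─⁺ (∈-⋂⁺ (λ ()) (x∈X′ ∷ All.tail x∈XΓ)) x∉P

_[_↦_] : FinSet → ℕ → ℕ → FinSet
D [ e ↦ y ] = y ∷ (D ─ (e ∷ []))

exchange : Partner (D ∷ Γ) e y → e ∈ D → hkeSum (D ∷ Γ) ≡ hkeSum ((D [ e ↦ y ]) ∷ Γ)
exchange {D} {Γ} {e} {y} py e∈D = begin
  hkeSum (D ∷ Γ)
    ≡⟨ hkeSum-split (D ∷ Γ) P ⟩
  (∣ ⋃ (D ∷ Γ) ∩ P ∣ + ∣ ⋂ (D ∷ Γ) ∩ P ∣) + (∣ ⋃ (D ∷ Γ) ─ P ∣ + ∣ ⋂ (D ∷ Γ) ─ P ∣)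
    ≡⟨ cong₂ _+_ (trans (pair-count py (∈-++⁺ˡ e∈D)) (sym pair-count′))
                 (cong₂ _+_ (∣∣-cong (⋃∷-─-mono {P} {D} {D′} D─P⊆D′─P Γ , ⋃∷-─-mono {P} {D′} {D} D′─P⊆D─P Γ))
                            (∣∣-cong (⋂∷-─-mono {P} {D} {D′} D─P⊆D′─P Γ , ⋂∷-─-mono {P} {D′} {D} D′─P⊆D─P Γ))) ⟩
  (∣ ⋃ (D′ ∷ Γ) ∩ P ∣ + ∣ ⋂ (D′ ∷ Γ) ∩ P ∣) + (∣ ⋃ (D′ ∷ Γ) ─ P ∣ + ∣ ⋂ (D′ ∷ Γ) ─ P ∣)
    ≡⟨ hkeSum-split (D′ ∷ Γ) P ⟨
  hkeSum (D′ ∷ Γ) ∎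
  where
  P : FinSet
  P = e ∷ y ∷ []
  D′ : FinSet
  D′ = D [ e ↦ y ]
  y∉D : y ∉ D
  y∉D y∈D = proj₁ (py (here refl)) y∈D e∈D
  e∉D′ : e ∉ D′
  e∉D′ (here refl) = y∉D e∈D
  e∉D′ (there e∈D─e) = proj₂ (∈-─⁻ D (e ∷ []) e∈D─e) (here refl)
  D─P⊆D′─P : (D ─ P) ⊆ (D′ ─ P)
  D─P⊆D′─P p = let x∈D , x∉P = ∈-─⁻ D P p
               in ∈-─⁺ {X = D′} {Y = P} (there (∈-─⁺ {Y = e ∷ []} x∈D λ { (here refl) → x∉P (here refl) })) x∉P
  D′─P⊆D─P : (D′ ─ P) ⊆ (D ─ P)
  D′─P⊆D─P p with ∈-─⁻ D′ P p
  ... | here refl , x∉P = ⊥-elim (x∉P (there (here refl)))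
  ... | there x∈D─e , x∉P = ∈-─⁺ (proj₁ (∈-─⁻ D (e ∷ []) x∈D─e)) x∉P
  py′ : Partner (D′ ∷ Γ) y e
  py′ (here refl) = (λ e∈D′ → ⊥-elim (e∉D′ e∈D′)) , (λ y∉D′ → ⊥-elim (y∉D′ (here refl)))
  py′ (there X∈Γ) = partner-sym py (there X∈Γ)
  P≈yeP : P ≈ (y ∷ e ∷ [])
  P≈yeP = (λ { (here refl) → there (here refl) ; (there (here refl)) → here refl })
        , (λ { (here refl) → there (here refl) ; (there (here refl)) → here refl })
  pair-count′ : ∣ ⋃ (D′ ∷ Γ) ∩ P ∣ + ∣ ⋂ (D′ ∷ Γ) ∩ P ∣ ≡ 2
  pair-count′ = trans (cong₂ _+_ (∣∣-cong (∩-congʳ (⋃ (D′ ∷ Γ)) P≈yeP)) (∣∣-cong (∩-congʳ (⋂ (D′ ∷ Γ)) P≈yeP)))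
                      (pair-count py′ (here refl))

hke-exchange : ∀ {α} → HasHKESum G α → D ∈ G → e ∈ D → Partner G e y →
  HasHKESum ((D [ e ↦ y ]) ∷ G) α
hke-exchange {G} {D} {e} {y} {α} hke D∈G e∈D py Γ Γ≢[] Γ⊑D′G with D [ e ↦ y ] ∈ᶜ? Γ
... | no D′∉Γ = hke Γ Γ≢[] Γ⊑G
  where
  Γ⊑G : Γ ⊑ G
  Γ⊑G X∈Γ with Γ⊑D′G X∈Γ
  ... | here refl = ⊥-elim (D′∉Γ X∈Γ)
  ... | there X∈G = X∈G
... | yes D′∈Γ = begin
  hkeSum Γ         ≡⟨ hkeSum-cong Γ≢[] (λ ()) Γ⊑D′Γ⁻ D′Γ⁻⊑Γ ⟩
  hkeSum (D′ ∷ Γ⁻) ≡⟨ exchange (λ X∈DΓ⁻ → py (DΓ⁻⊑G X∈DΓ⁻)) e∈D ⟨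
  hkeSum (D ∷ Γ⁻)  ≡⟨ hke (D ∷ Γ⁻) (λ ()) DΓ⁻⊑G ⟩
  2 * α            ∎
  where
  D′ : FinSet
  D′ = D [ e ↦ y ]
  Γ⁻ : Collection
  Γ⁻ = filter (λ X → ¬? (X ≟ᶜ D′)) Γ
  Γ⊑D′Γ⁻ : Γ ⊑ (D′ ∷ Γ⁻)
  Γ⊑D′Γ⁻ {X} X∈Γ with X ≟ᶜ D′
  ... | yes refl = here refl
  ... | no X≢D′ = there (∈-filter⁺ (λ X → ¬? (X ≟ᶜ D′)) X∈Γ X≢D′)
  D′Γ⁻⊑Γ : (D′ ∷ Γ⁻) ⊑ Γ
  D′Γ⁻⊑Γ (here refl) = D′∈Γ
  D′Γ⁻⊑Γ (there X∈Γ⁻) = proj₁ (∈-filter⁻ (λ X → ¬? (X ≟ᶜ D′)) {xs = Γ} X∈Γ⁻)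
  DΓ⁻⊑G : (D ∷ Γ⁻) ⊑ G
  DΓ⁻⊑G (here refl) = D∈G
  DΓ⁻⊑G (there X∈Γ⁻) with ∈-filter⁻ (λ X → ¬? (X ≟ᶜ D′)) {xs = Γ} X∈Γ⁻
  ... | X∈Γ , X≢D′ with Γ⊑D′G X∈Γ
  ...   | here X≡D′ = ⊥-elim (X≢D′ X≡D′)
  ...   | there X∈G = X∈G

hke-⊑ : IsHKE G → Γ ⊑ G → Γ ≢ [] → IsHKE Γ
hke-⊑ (_ , α , α>0 , hke) Γ⊑G Γ≢[] = Γ≢[] , α , α>0 , λ Δ Δ≢[] Δ⊑Γ → hke Δ Δ≢[] (λ X∈Δ → Γ⊑G (Δ⊑Γ X∈Δ))

partners-∉ : ∀ {R Ys} → Pointwise (Partner G) R Ys → X ∈ G → R ⊆ X → All (_∉ X) Ys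
partners-∉ [] _ _ = []
partners-∉ (py ∷ pys) X∈G R⊆X =
  (λ y∈X → proj₁ (py X∈G) y∈X (R⊆X (here refl))) ∷ partners-∉ pys X∈G (λ r∈R → R⊆X (there r∈R))

exchange-─≈ : ∀ {R Ys} → y ∉ R → (((D [ e ↦ y ]) ─ R) ++ Ys) ≈ ((D ─ (e ∷ R)) ++ (y ∷ Ys))
exchange-─≈ {y} {D} {e} {R} {Ys} y∉R = to , from
  where
  to : (((D [ e ↦ y ]) ─ R) ++ Ys) ⊆ ((D ─ (e ∷ R)) ++ (y ∷ Ys))
  to p with ∈-++⁻ ((D [ e ↦ y ]) ─ R) p
  ... | inj₂ x∈Ys = ∈-++⁺ʳ (D ─ (e ∷ R)) (there x∈Ys)
  ... | inj₁ x∈D′─R with ∈-─⁻ (D [ e ↦ y ]) R x∈D′─R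
  ...   | here refl , _ = ∈-++⁺ʳ (D ─ (e ∷ R)) (here refl)
  ...   | there x∈D─e , x∉R = let x∈D , x∉e = ∈-─⁻ D (e ∷ []) x∈D─e in
    ∈-++⁺ˡ (∈-─⁺ {Y = e ∷ R} x∈D λ { (here refl) → x∉e (here refl) ; (there x∈R) → x∉R x∈R })
  from : ((D ─ (e ∷ R)) ++ (y ∷ Ys)) ⊆ (((D [ e ↦ y ]) ─ R) ++ Ys)
  from p with ∈-++⁻ (D ─ (e ∷ R)) p
  ... | inj₂ (here refl) = ∈-++⁺ˡ (∈-─⁺ {X = D [ e ↦ y ]} {Y = R} (here refl) y∉R)
  ... | inj₂ (there x∈Ys) = ∈-++⁺ʳ ((D [ e ↦ y ]) ─ R) x∈Ys
  ... | inj₁ x∈D─eR = let x∈D , x∉eR = ∈-─⁻ D (e ∷ R) x∈D─eR in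
    ∈-++⁺ˡ (∈-─⁺ {X = D [ e ↦ y ]} {Y = R} (there (∈-─⁺ {Y = e ∷ []} x∈D λ { (here refl) → x∉eR (here refl) }))
                                          (λ x∈R → x∉eR (there x∈R)))

record Replacement (G : Collection) (D : FinSet) (R : List ℕ) : Set where
  field
    replaced : FinSet
    partners : List ℕ
    isHKE : IsHKE (replaced ∷ G)
    partnered : Pointwise (Partner G) R partners
    partners-unique : Unique partners
    replaced≈ : replaced ≈ ((D ─ R) ++ partners)

replace : ∀ {R} → IsHKE G → D ∈ G → Unique R → R ⊆ D → Replacement G D R
replace {G} {D} {[]} hke D∈G _ _ = record
  { replaced = D
  ; partners = []
  ; isHKE = hke-⊑ hke DG⊑G (λ ())
  ; partnered = []
  ; partners-unique = []
  ; replaced≈ = (λ x∈D → ∈-++⁺ˡ (∈-─⁺ x∈D λ ())) , (λ p → [ (λ q → proj₁ (∈-─⁻ D [] q)) , (λ ()) ] (∈-++⁻ (D ─ []) p))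
  }
  where
  DG⊑G : (D ∷ G) ⊑ G
  DG⊑G (here refl) = D∈G
  DG⊑G (there X∈G) = X∈G
replace {G} {D} {e ∷ R} hke@(_ , α , α>0 , sums) D∈G (e∉R ∷ R-unique) eR⊆D
  with partner-exists {α = α} sums D∈G (eR⊆D (here refl))
... | y , py = record
  { replaced = replaced
  ; partners = y ∷ partners
  ; isHKE = hke-⊑ isHKE D″G⊑D″D′G (λ ())
  ; partnered = py ∷ Pointwise.map (λ pe {X} X∈G → pe (there X∈G)) partnered
  -- the later partners are partners in D′ ∷ G, so they miss D′ ∋ y
  ; partners-unique = All.map (λ y′∉D′ y≡y′ → y′∉D′ (subst (_∈ D′) y≡y′ (here refl))) (partners-∉ partnered (here refl) R⊆D′)
                      ∷ partners-unique
  ; replaced≈ = ≈-trans replaced≈ (exchange-─≈ {D = D} {e} (λ y∈R → y∉D (eR⊆D (there y∈R))))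
  }
  where
  D′ : FinSet
  D′ = D [ e ↦ y ]
  y∉D : y ∉ D
  y∉D y∈D = proj₁ (py D∈G) y∈D (eR⊆D (here refl))
  R⊆D′ : R ⊆ D′
  R⊆D′ {x} x∈R = there (∈-─⁺ (eR⊆D (there x∈R)) λ { (here refl) → All.lookup e∉R x∈R refl })
  hke′ : IsHKE (D′ ∷ G)
  hke′ = (λ ()) , α , α>0 , hke-exchange {α = α} sums D∈G (eR⊆D (here refl)) py
  open Replacement (replace hke′ (here refl) R-unique R⊆D′)
  D″G⊑D″D′G : (replaced ∷ G) ⊑ (replaced ∷ D′ ∷ G)
  D″G⊑D″D′G (here refl) = here refl
  D″G⊑D″D′G (there X∈G) = there (there X∈G)

length-partners∉⋃ : ∀ {R Ys} → Γ ≢ [] → Pointwise (Partner Γ) R Ys →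
  length (filter (λ y → ¬? (y ∈? ⋃ Γ)) Ys) ≡ length (filter (_∈? ⋂ Γ) R)
length-partners∉⋃ Γ≢[] [] = refl
length-partners∉⋃ {Γ} {e ∷ R} {y ∷ Ys} Γ≢[] (py ∷ pys) with partner-⋂⋃ Γ≢[] py | e ∈? ⋂ Γ | y ∈? ⋃ Γ
... | e∈⋂⇒y∉⋃ , _ | yes e∈⋂ | yes y∈⋃ = ⊥-elim (e∈⋂⇒y∉⋃ e∈⋂ y∈⋃)
... | _ | yes _ | no _ = cong suc (length-partners∉⋃ Γ≢[] pys)
... | _ | no _ | yes _ = length-partners∉⋃ Γ≢[] pys
... | _ , y∉⋃⇒e∈⋂ | no e∉⋂ | no y∉⋃ = ⊥-elim (e∉⋂ (y∉⋃⇒e∈⋂ y∉⋃))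

partners-⊆⋃ : ∀ {R Ys} → Γ ≢ [] → (∀ x → x ∉ ⋂ Γ) → Pointwise (Partner Γ) R Ys → All (_∈ ⋃ Γ) Ys
partners-⊆⋃ Γ≢[] ⋂Γ≡∅ [] = []
partners-⊆⋃ {Γ} {e ∷ R} {y ∷ Ys} Γ≢[] ⋂Γ≡∅ (py ∷ pys) with y ∈? ⋃ Γ
... | yes y∈⋃ = y∈⋃ ∷ partners-⊆⋃ Γ≢[] ⋂Γ≡∅ pys
... | no y∉⋃ = ⊥-elim (⋂Γ≡∅ e (proj₂ (partner-⋂⋃ Γ≢[] py) y∉⋃))

moved : FinSet → FinSet → List ℕ
moved A E = deduplicate _≟_ (A ─ E)

∈-moved⁻ : ∀ A E → x ∈ moved A E → x ∈ A × x ∉ E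
∈-moved⁻ A E p = ∈-─⁻ A E (∈-deduplicate⁻ _≟_ (A ─ E) p)

∈-moved⁺ : x ∈ X → x ∉ Y → x ∈ moved X Y
∈-moved⁺ x∈X x∉Y = ∈-deduplicate⁺ _≟_ (∈-─⁺ x∈X x∉Y)

module _ {F A E} (A∈F : A ∈ F) (E⊆A : E ⊆ A) (r : Replacement F A (moved A E)) where
  open Replacement r

  partners∉A : All (_∉ A) partners
  partners∉A = partners-∉ partnered A∈F (λ p → proj₁ (∈-moved⁻ A E p))

  ∈-replaced⁻ : x ∈ replaced → (x ∈ A × x ∉ moved A E) ⊎ x ∈ partners
  ∈-replaced⁻ p with ∈-++⁻ (A ─ moved A E) (proj₁ replaced≈ p)
  ... | inj₁ q = inj₁ (∈-─⁻ A (moved A E) q)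
  ... | inj₂ q = inj₂ q

  A∩replaced≈E : (A ∩ replaced) ≈ E
  A∩replaced≈E = A∩replaced⊆E , (λ x∈E → ∈-∩⁺ (E⊆A x∈E) (proj₂ replaced≈ (∈-++⁺ˡ (∈-─⁺ (E⊆A x∈E) λ x∈moved → proj₂ (∈-moved⁻ A E x∈moved) x∈E))))
    where
    A∩replaced⊆E : (A ∩ replaced) ⊆ E
    A∩replaced⊆E {x} p with ∈-∩⁻ A replaced p
    ... | x∈A , x∈replaced with ∈-replaced⁻ x∈replaced | x ∈? E
    ...   | _ | yes x∈E = x∈E
    ...   | inj₁ (_ , x∉moved) | no x∉E = ⊥-elim (x∉moved (∈-moved⁺ x∈A x∉E))
    ...   | inj₂ x∈partners | no _ = ⊥-elim (All.lookup partners∉A x∈partners x∈A)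

  ∣replaced─⋃∣ : ∣ replaced ─ ⋃ F ∣ ≡ ∣ ⋂ F ─ E ∣
  ∣replaced─⋃∣ = begin
    ∣ replaced ─ ⋃ F ∣                                ≡⟨ ∣∣-unique (Unique.filter⁺ (λ y → ¬? (y ∈? ⋃ F)) partners-unique) (to₁ , from₁) ⟩
    length (filter (λ y → ¬? (y ∈? ⋃ F)) partners)   ≡⟨ length-partners∉⋃ (∈⇒≢[] A∈F) partnered ⟩
    length (filter (_∈? ⋂ F) (moved A E))              ≡⟨ ∣∣-unique (Unique.filter⁺ (_∈? ⋂ F) (deduplicate-! (A ─ E))) (to₂ , from₂) ⟨
    ∣ ⋂ F ─ E ∣                                       ∎
    where
    to₁ : (replaced ─ ⋃ F) ⊆ filter (λ y → ¬? (y ∈? ⋃ F)) partners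
    to₁ p with ∈-─⁻ replaced (⋃ F) p
    ... | x∈replaced , x∉⋃F with ∈-replaced⁻ x∈replaced
    ...   | inj₁ (x∈A , _) = ⊥-elim (x∉⋃F (∈-concat⁺′ x∈A A∈F))
    ...   | inj₂ x∈partners = ∈-filter⁺ (λ y → ¬? (y ∈? ⋃ F)) x∈partners x∉⋃F
    from₁ : filter (λ y → ¬? (y ∈? ⋃ F)) partners ⊆ (replaced ─ ⋃ F)
    from₁ p = let x∈partners , x∉⋃F = ∈-filter⁻ (λ y → ¬? (y ∈? ⋃ F)) {xs = partners} p
              in ∈-─⁺ (proj₂ replaced≈ (∈-++⁺ʳ (A ─ moved A E) x∈partners)) x∉⋃F
    to₂ : (⋂ F ─ E) ⊆ filter (_∈? ⋂ F) (moved A E)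
    to₂ p = let x∈⋂F , x∉E = ∈-─⁻ (⋂ F) E p
            in ∈-filter⁺ (_∈? ⋂ F) (∈-moved⁺ (⋂⊆ A∈F x∈⋂F) x∉E) x∈⋂F
    from₂ : filter (_∈? ⋂ F) (moved A E) ⊆ (⋂ F ─ E)
    from₂ p = let x∈moved , x∈⋂F = ∈-filter⁻ (_∈? ⋂ F) {xs = moved A E} p
              in ∈-─⁺ x∈⋂F (proj₂ (∈-moved⁻ A E x∈moved))

  replaced⊆⋃ : (∀ x → x ∉ ⋂ F) → replaced ⊆ ⋃ F
  replaced⊆⋃ ⋂F≡∅ p with ∈-replaced⁻ p
  ... | inj₁ (x∈A , _) = ∈-concat⁺′ x∈A A∈F
  ... | inj₂ x∈partners = All.lookup (partners-⊆⋃ (∈⇒≢[] A∈F) ⋂F≡∅ partnered) x∈partners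

mainTheorem15 : (F : Collection) → IsHKE F →
    (A : FinSet) → A ∈ F → (E : FinSet) → E ⊆ A →
    ∃[ D ] (((A ∩ D) ≈ E)
      × IsHKE (D ∷ F)
      × (∣ D ─ ⋃ F ∣ ≡ ∣ ⋂ F ─ E ∣)
      × ((∀ (x : ℕ) → x ∉ ⋂ F) → D ⊆ ⋃ F))
mainTheorem15 F hke A A∈F E E⊆A =
  replaced , A∩replaced≈E A∈F E⊆A r , isHKE , ∣replaced─⋃∣ A∈F E⊆A r , replaced⊆⋃ A∈F E⊆A r
  where
  r : Replacement F A (moved A E)
  r = replace hke A∈F (deduplicate-! (A ─ E)) (λ p → proj₁ (∈-moved⁻ A E p))
  open Replacement r
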